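{- Let $\pi$ be a degree sequence of length $n$, viewed as assigning degrees $d_x$ to a vertex set $V$. Suppose there is a vertex $v$ that is good and dull and whose degree $d = d_v \ge 3$ is not shared by any other vertex. Let $\beta_v = \{w : d_w = d+1\}$, $j = \beta_v \cup \{v\}$, $i = \{u : d_u < 3\}$, and let $B$ be the set of bad vertices. If either (a) $\sum_{x \in B} d_x < \sum_{x \in j} d_x + 1$, or (b) $d > n - (|i| + 3 + \mu_i)/2$, then $\pi$ is ds-reconstruction-forcing.
   Context: All graphs are finite and simple. A degree $d$ is bad if $d-1$ also occurs in the sequence, dull if $d+1$ occurs; a vertex is bad/dull according as its degree is; good means not bad. $\mu_i = 1$ if $V \setminus i$ is neighbourly and $0$ otherwise, where a set $K$ is neighbourly if $\{d_u : u \notin K\} \cap \{d_u - 1 : u \in K\} = \emptyset$. A vertex $v$ of a graph $G$ is ds-completable if, for each integer $d$, the vertices having degree $d$ in $G-v$ are either all neighbours of $v$ in $G$ or all non-neighbours. A graph is ds-reconstructible if it has a ds-completable vertex; a degree sequence is ds-reconstruction-forcing if every graph realizing it is ds-reconstructible (non-graphic sequences are deemed forcing). -}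

module Defs where

open import Data.Nat using (ℕ; _+_; _<_; _≟_; _<?_)
open import Data.Bool using (Bool; true; false; if_then_else_; not; _∧_; _∨_)
open import Data.Fin using (Fin)
import Data.Fin as F
open import Data.Fin.Properties using (any?)
open import Data.List using (List; map; allFin)
open import Data.Nat.ListAction using (sum)
open import Data.Product using (∃; Σ; _×_; _,_)
open import Data.Sum using (_⊎_)
open import Relation.Nullary using (¬_; yes; no; Dec; ¬?)
import Data.Bool as B
open import Relation.Nullary.Decidable using (⌊_⌋; _×-dec_)
open import Relation.Binary.PropositionalEquality using (_≡_; _≢_)

record Graph (n : ℕ) : Set where
  field
    adj    : Fin n → Fin n → Bool
    sym    : ∀ x y → adj x y ≡ adj y x
    irrefl : ∀ x → adj x x ≡ false
open Graph public

VSet : ℕ → Set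
VSet n = Fin n → Bool

sumOver : ∀ {n} → VSet n → (Fin n → ℕ) → ℕ
sumOver {n} S f = sum (map (λ x → if S x then f x else 0) (allFin n))

card : ∀ {n} → VSet n → ℕ
card S = sumOver S (λ _ → 1)

deg : ∀ {n} → Graph n → Fin n → ℕ
deg G x = card (adj G x)

-- degree of u in G - v (meaningful for u ≠ v)
degDel : ∀ {n} → Graph n → Fin n → Fin n → ℕ
degDel G v u = card (λ y → not ⌊ y F.≟ v ⌋ ∧ adj G u y)

DsCompletable : ∀ {n} → Graph n → Fin n → Set
DsCompletable G v = ∀ (d : ℕ) →
    (∀ u → u ≢ v → degDel G v u ≡ d → adj G v u ≡ true)
  ⊎ (∀ u → u ≢ v → degDel G v u ≡ d → adj G v u ≡ false)

DsReconstructible : ∀ {n} → Graph n → Set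
DsReconstructible {n} G = ∃ λ (v : Fin n) → DsCompletable G v

Realizes : ∀ {n} → Graph n → (Fin n → ℕ) → Set
Realizes G π = ∀ x → deg G x ≡ π x

-- every graph realizing π is ds-reconstructible
-- (vacuously true for non-graphic π)
DsReconstructionForcing : ∀ {n} → (Fin n → ℕ) → Set
DsReconstructionForcing {n} π = ∀ (G : Graph n) → Realizes G π → DsReconstructible G

Bad : ∀ {n} → (Fin n → ℕ) → Fin n → Set
Bad π x = ∃ λ y → π y + 1 ≡ π x

Dull : ∀ {n} → (Fin n → ℕ) → Fin n → Set
Dull π x = ∃ λ y → π y ≡ π x + 1

Good : ∀ {n} → (Fin n → ℕ) → Fin n → Set
Good π x = ¬ Bad π x

badSet : ∀ {n} → (Fin n → ℕ) → VSet n
badSet π x = ⌊ any? (λ y → π y + 1 ≟ π x) ⌋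

Neighbourly : ∀ {n} → (Fin n → ℕ) → VSet n → Set
Neighbourly π K = ¬ (∃ λ u → ∃ λ w →
  (K u ≡ false) × (K w ≡ true) × (π u + 1 ≡ π w))

neighbourly? : ∀ {n} (π : Fin n → ℕ) (K : VSet n) → Dec (Neighbourly π K)
neighbourly? π K = ¬? (any? λ u → any? λ w →
  (K u B.≟ false) ×-dec (K w B.≟ true) ×-dec (π u + 1 ≟ π w))

μ : ∀ {n} → (Fin n → ℕ) → VSet n → ℕ
μ π K = if ⌊ neighbourly? π (λ x → not (K x)) ⌋ then 1 else 0

jSet : ∀ {n} → (Fin n → ℕ) → Fin n → VSet n
jSet π v x = ⌊ x F.≟ v ⌋ ∨ ⌊ π x ≟ π v + 1 ⌋

iSet : ∀ {n} → (Fin n → ℕ) → VSet n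
iSet π x = ⌊ π x <? 3 ⌋

module Submission where

-- A vertex w of a graph G fails to be ds-completable only
-- if it has a *conflict*: a neighbour p and a non-neighbour q ≠ w with
-- deg p = deg q + 1 (the two vertices then have equal degree in G - w but lie on
-- different sides of w).  So it suffices to show that a realization G of π in
-- which every vertex has a conflict contradicts both (a) and (b).
--  (a) For each w in the closed neighbourhood N[v], the conflict neighbour of w
--      is bad and not in β_v (otherwise its partner would be v itself).  Double
--      counting edges between N[v] and B ∖ β_v gives 1 + d ≤ Σ_{B∖β_v} d_x,
--      i.e. Σ_B d_x ≥ Σ_j d_x + 1.
--  (b) Take b with d_b = d + 1.  Every low-degree neighbour of v has degree 2
--      and is a non-neighbour of b; counting vertices around v and around b
--      gives 2d + |i| + 3 + μ_i ≤ 2n.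

open import Defs hiding (sym)
open import Data.Nat using (ℕ; zero; suc; _+_; _*_; _<_; _≤_; z≤n; s≤s; _≟_; _<?_)
open import Data.Nat.Properties
open import Data.Nat.Tactic.RingSolver using (solve-∀)
open import Data.Bool using (Bool; true; false; if_then_else_; not; _∧_; _∨_)
import Data.Bool.Properties as BoolP
open import Data.Fin using (Fin)
import Data.Fin as F
import Data.Fin.Properties as FinP
open import Data.List using (map; tabulate)
import Data.Nat.ListAction as List
open import Data.Product using (∃; _×_; _,_; proj₁; proj₂)
open import Data.Sum using (_⊎_; inj₁; inj₂)
open import Data.Empty using (⊥; ⊥-elim)
open import Function using (_∘_; id)
open import Relation.Nullary using (¬_; yes; no; Dec; ¬?; contradiction)
open import Relation.Nullary.Decidable using (⌊_⌋; _×-dec_; dec-true; dec-false; isYes≗does)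
open import Relation.Binary.PropositionalEquality
open import Algebra.Properties.CommutativeMonoid.Sum +-0-commutativeMonoid
  using (sum; sum-cong-≗; ∑-distrib-+; ∑-comm; sum-replicate-zero)

⌊⌋-true : ∀ {p} {P : Set p} (d : Dec P) → P → ⌊ d ⌋ ≡ true
⌊⌋-true d x = trans (isYes≗does d) (dec-true d x)

⌊⌋-false : ∀ {p} {P : Set p} (d : Dec P) → ¬ P → ⌊ d ⌋ ≡ false
⌊⌋-false d x = trans (isYes≗does d) (dec-false d x)

∧-true : ∀ {a b : Bool} → a ∧ b ≡ true → a ≡ true × b ≡ true
∧-true {true} {true} refl = refl , refl

[_]·_ : Bool → ℕ → ℕ
[ b ]· k = if b then k else 0

∑-mono : ∀ {n} {f g : Fin n → ℕ} → (∀ x → f x ≤ g x) → sum f ≤ sum g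
∑-mono {zero}  f≤g = z≤n
∑-mono {suc n} f≤g = +-mono-≤ (f≤g F.zero) (∑-mono (f≤g ∘ F.suc))

∑-term : ∀ {n} (f : Fin n → ℕ) (a : Fin n) → f a ≤ sum f
∑-term f F.zero    = m≤m+n _ _
∑-term f (F.suc a) = ≤-trans (∑-term (f ∘ F.suc) a) (m≤n+m _ (f F.zero))

∑-supported : ∀ {n} (f : Fin n → ℕ) (a : Fin n) → (∀ x → x ≢ a → f x ≡ 0) → sum f ≡ f a
∑-supported {suc n} f F.zero off = begin
    f F.zero + sum (f ∘ F.suc)   ≡⟨ cong (f F.zero +_) (sum-cong-≗ (λ x → off (F.suc x) λ ())) ⟩
    f F.zero + sum {n} (λ _ → 0) ≡⟨ cong (f F.zero +_) (sum-replicate-zero n) ⟩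
    f F.zero + 0                 ≡⟨ +-identityʳ _ ⟩
    f F.zero                     ∎
  where open ≡-Reasoning
∑-supported f (F.suc a) off = begin
    f F.zero + sum (f ∘ F.suc) ≡⟨ cong (_+ sum (f ∘ F.suc)) (off F.zero λ ()) ⟩
    sum (f ∘ F.suc)            ≡⟨ ∑-supported (f ∘ F.suc) a (λ x x≢a → off (F.suc x) (x≢a ∘ FinP.suc-injective)) ⟩
    f (F.suc a)                ∎
  where open ≡-Reasoning

∑-guard : ∀ {n} (b : Bool) (f : Fin n → ℕ) → [ b ]· sum f ≡ sum (λ x → [ b ]· f x)
∑-guard     true  f = refl
∑-guard {n} false f = sym (sum-replicate-zero n)

∑-one : ∀ {n} → sum {n} (λ _ → 1) ≡ n
∑-one {zero}  = refl
∑-one {suc n} = cong suc (∑-one {n})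

module _ {n : ℕ} where

  infixr 7 _∩_
  infixl 6 _─_

  _∩_ : VSet n → VSet n → VSet n
  (P ∩ Q) x = P x ∧ Q x

  ∁ : VSet n → VSet n
  ∁ P x = not (P x)

  ｛_｝ : Fin n → VSet n
  ｛ a ｝ x = ⌊ x F.≟ a ⌋

  _─_ : VSet n → Fin n → VSet n
  P ─ a = ∁ ｛ a ｝ ∩ P

  _⊆_ : VSet n → VSet n → Set
  P ⊆ Q = ∀ x → P x ≡ true → Q x ≡ true

  ∈｛｝ : (a : Fin n) → ｛ a ｝ a ≡ true
  ∈｛｝ a = ⌊⌋-true (a F.≟ a) refl

  ∉｛｝ : {x a : Fin n} → x ≢ a → ｛ a ｝ x ≡ false
  ∉｛｝ {x} {a} x≢a = ⌊⌋-false (x F.≟ a) x≢a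

  ∈─ : (P : VSet n) {a c : Fin n} → P c ≡ true → c ≢ a → (P ─ a) c ≡ true
  ∈─ P Pc c≢a rewrite ∉｛｝ c≢a | Pc = refl

sumOver-∑ : ∀ {n} (P : VSet n) (f : Fin n → ℕ) → sumOver P f ≡ sum (λ x → [ P x ]· f x)
sumOver-∑ {n} P f = listSum-tabulate id
  where
  g : Fin n → ℕ
  g x = [ P x ]· f x
  listSum-tabulate : ∀ {k} (h : Fin k → Fin n) → List.sum (map g (tabulate h)) ≡ sum (g ∘ h)
  listSum-tabulate {zero}  h = refl
  listSum-tabulate {suc k} h = cong (g (h F.zero) +_) (listSum-tabulate (h ∘ F.suc))

sumOver-cong : ∀ {n} {P Q : VSet n} (f : Fin n → ℕ) → (∀ x → P x ≡ Q x) → sumOver P f ≡ sumOver Q f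
sumOver-cong {P = P} {Q} f P≗Q = begin
  sumOver P f                  ≡⟨ sumOver-∑ P f ⟩
  sum (λ x → [ P x ]· f x)     ≡⟨ sum-cong-≗ (λ x → cong ([_]· f x) (P≗Q x)) ⟩
  sum (λ x → [ Q x ]· f x)     ≡⟨ sumOver-∑ Q f ⟨
  sumOver Q f                  ∎
  where open ≡-Reasoning

sumOver-mono : ∀ {n} {P Q : VSet n} (f : Fin n → ℕ) → P ⊆ Q → sumOver P f ≤ sumOver Q f
sumOver-mono {P = P} {Q} f P⊆Q = begin
  sumOver P f                  ≡⟨ sumOver-∑ P f ⟩
  sum (λ x → [ P x ]· f x)     ≤⟨ ∑-mono pointwise ⟩
  sum (λ x → [ Q x ]· f x)     ≡⟨ sumOver-∑ Q f ⟨
  sumOver Q f                  ∎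
  where
  open ≤-Reasoning
  pointwise : ∀ x → [ P x ]· f x ≤ [ Q x ]· f x
  pointwise x with P x in Px
  ... | false = z≤n
  ... | true rewrite P⊆Q x Px = ≤-refl

sumOver-split : ∀ {n} (P Q : VSet n) (f : Fin n → ℕ) →
                sumOver P f ≡ sumOver (Q ∩ P) f + sumOver (∁ Q ∩ P) f
sumOver-split P Q f = begin
  sumOver P f                                           ≡⟨ sumOver-∑ P f ⟩
  sum (λ x → [ P x ]· f x)                              ≡⟨ sum-cong-≗ pointwise ⟩
  sum (λ x → [ (Q ∩ P) x ]· f x + [ (∁ Q ∩ P) x ]· f x) ≡⟨ ∑-distrib-+ (λ x → [ (Q ∩ P) x ]· f x) (λ x → [ (∁ Q ∩ P) x ]· f x) ⟩
  sum (λ x → [ (Q ∩ P) x ]· f x) + sum (λ x → [ (∁ Q ∩ P) x ]· f x)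
    ≡⟨ cong₂ _+_ (sumOver-∑ (Q ∩ P) f) (sumOver-∑ (∁ Q ∩ P) f) ⟨
  sumOver (Q ∩ P) f + sumOver (∁ Q ∩ P) f               ∎
  where
  open ≡-Reasoning
  pointwise : ∀ x → [ P x ]· f x ≡ [ (Q ∩ P) x ]· f x + [ (∁ Q ∩ P) x ]· f x
  pointwise x with Q x | P x
  ... | true  | true  = sym (+-identityʳ _)
  ... | true  | false = refl
  ... | false | true  = refl
  ... | false | false = refl

sumOver-pick : ∀ {n} (P : VSet n) (a : Fin n) (f : Fin n → ℕ) →
               sumOver P f ≡ [ P a ]· f a + sumOver (P ─ a) f
sumOver-pick P a f = trans (sumOver-split P ｛ a ｝ f) (cong (_+ sumOver (P ─ a) f) atPoint)
  where
  atPoint : sumOver (｛ a ｝ ∩ P) f ≡ [ P a ]· f a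
  atPoint = begin
    sumOver (｛ a ｝ ∩ P) f            ≡⟨ sumOver-∑ _ f ⟩
    sum (λ x → [ (｛ a ｝ ∩ P) x ]· f x) ≡⟨ ∑-supported _ a (λ x x≢a → cong (λ b → [ b ∧ P x ]· f x) (∉｛｝ x≢a)) ⟩
    [ (｛ a ｝ ∩ P) a ]· f a           ≡⟨ cong (λ b → [ b ∧ P a ]· f a) (∈｛｝ a) ⟩
    [ P a ]· f a                       ∎
    where open ≡-Reasoning

card-remove : ∀ {n} (P : VSet n) {a : Fin n} → P a ≡ true → card P ≡ suc (card (P ─ a))
card-remove P {a} Pa = trans (sumOver-pick P a _) (cong (λ b → [ b ]· 1 + card (P ─ a)) Pa)

card-≥2 : ∀ {n} (P : VSet n) {a c : Fin n} → a ≢ c → P a ≡ true → P c ≡ true → 2 ≤ card P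
card-≥2 P {a} {c} a≢c Pa Pc = begin
  2                              ≤⟨ s≤s (s≤s z≤n) ⟩
  suc (suc (card (P ─ a ─ c)))   ≡⟨ cong suc (card-remove (P ─ a) (∈─ P Pc (a≢c ∘ sym))) ⟨
  suc (card (P ─ a))             ≡⟨ card-remove P Pa ⟨
  card P                         ∎
  where open ≤-Reasoning

card-≥3 : ∀ {n} (P : VSet n) {a c e : Fin n} → a ≢ c → a ≢ e → c ≢ e →
          P a ≡ true → P c ≡ true → P e ≡ true → 3 ≤ card P
card-≥3 P {a} a≢c a≢e c≢e Pa Pc Pe = begin
  3                    ≤⟨ s≤s (card-≥2 (P ─ a) c≢e (∈─ P Pc (a≢c ∘ sym)) (∈─ P Pe (a≢e ∘ sym))) ⟩
  suc (card (P ─ a))   ≡⟨ card-remove P Pa ⟨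
  card P               ∎
  where open ≤-Reasoning

card-⊂ : ∀ {n} {P Q : VSet n} {t : Fin n} → P ⊆ Q → Q t ≡ true → P t ≡ false → suc (card P) ≤ card Q
card-⊂ {P = P} {Q} {t} P⊆Q Qt Pt = begin
  suc (card P)         ≤⟨ s≤s (sumOver-mono _ P⊆Q─t) ⟩
  suc (card (Q ─ t))   ≡⟨ card-remove Q Qt ⟨
  card Q               ∎
  where
  open ≤-Reasoning
  P⊆Q─t : P ⊆ (Q ─ t)
  P⊆Q─t x Px = ∈─ Q (P⊆Q x Px) (λ { refl → contradiction (trans (sym Pt) Px) λ () })

card-complement : ∀ {n} (P : VSet n) → card P + card (∁ P) ≡ n
card-complement {n} P = begin
  card P + card (∁ P)                 ≡⟨ cong₂ _+_ (sumOver-cong _ (λ x → sym (BoolP.∧-identityʳ (P x))))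
                                                   (sumOver-cong _ (λ x → sym (BoolP.∧-identityʳ (not (P x))))) ⟩
  card (P ∩ all) + card (∁ P ∩ all)   ≡⟨ sumOver-split all P _ ⟨
  card all                            ≡⟨ sumOver-∑ all _ ⟩
  sum {n} (λ _ → 1)                   ≡⟨ ∑-one ⟩
  n                                   ∎
  where
  open ≡-Reasoning
  all : VSet n
  all _ = true

module _ {n : ℕ} (G : Graph n) where

  adj-sym : ∀ {x y} {b : Bool} → adj G x y ≡ b → adj G y x ≡ b
  adj-sym {x} {y} e = trans (Graph.sym G y x) e

  deg-deleted : (w u : Fin n) → deg G u ≡ [ adj G u w ]· 1 + degDel G w u
  deg-deleted w u = sumOver-pick (adj G u) w _

  Conflict : Fin n → Set
  Conflict w = ∃ λ p → ∃ λ q →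
    adj G w p ≡ true × adj G w q ≡ false × q ≢ w × deg G p ≡ deg G q + 1

  conflict? : (w : Fin n) → Dec (Conflict w)
  conflict? w = FinP.any? λ p → FinP.any? λ q →
    (adj G w p BoolP.≟ true) ×-dec (adj G w q BoolP.≟ false) ×-dec ¬? (q F.≟ w) ×-dec (deg G p ≟ deg G q + 1)

  -- Two vertices with the same degree d in G - w on different sides of w form a conflict,
  -- so a conflict-free vertex is ds-completable.
  conflict-free⇒completable : (w : Fin n) → ¬ Conflict w → DsCompletable G w
  conflict-free⇒completable w noConflict d
    with FinP.any? (λ p → (adj G w p BoolP.≟ true) ×-dec (degDel G w p ≟ d))
  ... | yes (p , wp , dp) = inj₁ allNeighbours
    where
    allNeighbours : ∀ u → u ≢ w → degDel G w u ≡ d → adj G w u ≡ true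
    allNeighbours u u≢w du with adj G w u in wu
    ... | true  = refl
    ... | false = ⊥-elim (noConflict (p , u , wp , wu , u≢w , degrees))
      where
      open ≡-Reasoning
      degrees : deg G p ≡ deg G u + 1
      degrees = begin
        deg G p                               ≡⟨ deg-deleted w p ⟩
        [ adj G p w ]· 1 + degDel G w p       ≡⟨ cong₂ (λ b k → [ b ]· 1 + k) (adj-sym wp) dp ⟩
        suc d                                 ≡⟨ +-comm 1 d ⟩
        d + 1                                 ≡⟨ cong (_+ 1) (trans (sym du) (cong (λ b → [ b ]· 1 + degDel G w u) (sym (adj-sym wu)))) ⟩
        ([ adj G u w ]· 1 + degDel G w u) + 1 ≡⟨ cong (_+ 1) (deg-deleted w u) ⟨
        deg G u + 1                           ∎
  ... | no noNeighbour = inj₂ allNonNeighbours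
    where
    allNonNeighbours : ∀ u → u ≢ w → degDel G w u ≡ d → adj G w u ≡ false
    allNonNeighbours u u≢w du with adj G w u in wu
    ... | false = refl
    ... | true  = ⊥-elim (noNeighbour (u , wu , du))

  reconstructible-or-conflicted : DsReconstructible G ⊎ (∀ w → Conflict w)
  reconstructible-or-conflicted with FinP.any? (λ w → ¬? (conflict? w))
  ... | yes (w , noConflict) = inj₁ (w , conflict-free⇒completable w noConflict)
  ... | no  noneFree         = inj₂ conflicted
    where
    conflicted : ∀ w → Conflict w
    conflicted w with conflict? w
    ... | yes c          = c
    ... | no  noConflict = ⊥-elim (noneFree (w , noConflict))

  card≤∑deg : (π : Fin n → ℕ) → Realizes G π → (W X : VSet n) →
              (∀ w → W w ≡ true → ∃ λ y → X y ≡ true × adj G y w ≡ true) → card W ≤ sumOver X π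
  card≤∑deg π realizes W X dominated = begin
    card W                                                  ≡⟨ sumOver-∑ W _ ⟩
    sum (λ w → [ W w ]· 1)                                  ≤⟨ ∑-mono edgeToX ⟩
    sum (λ w → sum (λ y → [ X y ]· ([ adj G y w ]· 1)))     ≡⟨ ∑-comm (λ w y → [ X y ]· ([ adj G y w ]· 1)) ⟩
    sum (λ y → sum (λ w → [ X y ]· ([ adj G y w ]· 1)))     ≡⟨ sum-cong-≗ (λ y → ∑-guard (X y) (λ w → [ adj G y w ]· 1)) ⟨
    sum (λ y → [ X y ]· sum (λ w → [ adj G y w ]· 1))       ≡⟨ sum-cong-≗ (λ y → cong ([ X y ]·_) (trans (sym (sumOver-∑ (adj G y) _)) (realizes y))) ⟩
    sum (λ y → [ X y ]· π y)                                ≡⟨ sumOver-∑ X π ⟨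
    sumOver X π                                             ∎
    where
    open ≤-Reasoning
    edgeToX : ∀ w → [ W w ]· 1 ≤ sum (λ y → [ X y ]· ([ adj G y w ]· 1))
    edgeToX w with W w in Ww
    ... | false = z≤n
    ... | true with dominated w Ww
    ...   | y , Xy , yw = ≤-trans (≤-reflexive one) (∑-term _ y)
      where
      one : 1 ≡ [ X y ]· ([ adj G y w ]· 1)
      one rewrite Xy | yw = refl

  closedNbhd : Fin n → VSet n
  closedNbhd v x = ｛ v ｝ x ∨ adj G v x

  card-closedNbhd : (v : Fin n) → card (closedNbhd v) ≡ suc (deg G v)
  card-closedNbhd v = trans (card-remove (closedNbhd v) (cong (_∨ adj G v v) (∈｛｝ v)))
                            (cong suc (sumOver-cong _ openNbhd))
    where
    openNbhd : ∀ x → (closedNbhd v ─ v) x ≡ adj G v x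
    openNbhd x with x F.≟ v
    ... | yes refl = sym (Graph.irrefl G x)
    ... | no  _    = refl

  nonNbrs : Fin n → VSet n
  nonNbrs x = ∁ (adj G x) ─ x

  -- Every vertex is x, a neighbour of x, or a non-neighbour of x.
  vertex-count : (x : Fin n) → deg G x + suc (card (nonNbrs x)) ≡ n
  vertex-count x = trans (cong (deg G x +_) (sym (card-remove (∁ (adj G x)) (cong not (Graph.irrefl G x)))))
                         (card-complement (adj G x))

⌊⌋-sound : ∀ {p} {P : Set p} (d : Dec P) → ⌊ d ⌋ ≡ true → P
⌊⌋-sound (yes p) _ = p

+1-injective : ∀ {a b : ℕ} → a + 1 ≡ b + 1 → a ≡ b
+1-injective {a} {b} = +-cancelʳ-≡ 1 a b

n≢n+1 : ∀ k → k ≢ k + 1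
n≢n+1 k = <⇒≢ (m<m+n k (s≤s z≤n))

μ≤1 : ∀ {n} (π : Fin n → ℕ) (K : VSet n) → μ π K ≤ 1
μ≤1 π K with neighbourly? π (∁ K)
... | yes _ = ≤-refl
... | no  _ = z≤n

μ-vanishes : ∀ {n} (π : Fin n → ℕ) (K : VSet n) {u w : Fin n} →
             K u ≡ true → K w ≡ false → π u + 1 ≡ π w → μ π K ≡ 0
μ-vanishes π K {u} {w} Ku Kw step with neighbourly? π (∁ K)
... | yes neighbourly = ⊥-elim (neighbourly (u , w , cong not Ku , cong not Kw , step))
... | no  _           = refl

module Conflicted {n} (π : Fin n → ℕ) (v : Fin n) (unique : ∀ u → u ≢ v → π u ≢ π v)
  (G : Graph n) (realizes : Realizes G π) (conflicted : ∀ w → Conflict G w) where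

  conflict : ∀ w → ∃ λ p → ∃ λ q →
    adj G w p ≡ true × adj G w q ≡ false × q ≢ w × π p ≡ π q + 1
  conflict w with conflicted w
  ... | p , q , wp , wq , q≢w , degrees =
    p , q , wp , wq , q≢w , trans (sym (realizes p)) (trans degrees (cong (_+ 1) (realizes q)))

  is-v : ∀ {q} → π q ≡ π v → q ≡ v
  is-v {q} same with q F.≟ v
  ... | yes q≡v = q≡v
  ... | no  q≢v = ⊥-elim (unique q q≢v same)

  β : VSet n
  β x = ⌊ π x ≟ π v + 1 ⌋

  -- Vertices of β_v are bad (v witnesses it), so B splits as β_v and B ∖ β_v.
  bad-β : ∀ x → (β ∩ badSet π) x ≡ β x
  bad-β x with π x ≟ π v + 1
  ... | yes dx = ⌊⌋-true (FinP.any? (λ y → π y + 1 ≟ π x)) (v , sym dx)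
  ... | no  _  = refl

  -- j = {v} ⊎ β_v, since d_v ≠ d_v + 1.
  j─v : ∀ x → (jSet π v ─ v) x ≡ β x
  j─v x with x F.≟ v
  ... | yes refl = sym (⌊⌋-false (π x ≟ π x + 1) (n≢n+1 (π x)))
  ... | no  _    = refl

  sum-j : sumOver (jSet π v) π ≡ π v + sumOver β π
  sum-j = begin
    sumOver (jSet π v) π                               ≡⟨ sumOver-pick (jSet π v) v π ⟩
    [ jSet π v v ]· π v + sumOver (jSet π v ─ v) π     ≡⟨ cong₂ (λ b s → [ b ]· π v + s) (cong (_∨ β v) (∈｛｝ v)) (sumOver-cong π j─v) ⟩
    π v + sumOver β π                                  ∎
    where open ≡-Reasoning

  sum-bad : sumOver (badSet π) π ≡ sumOver β π + sumOver (∁ β ∩ badSet π) π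
  sum-bad = trans (sumOver-split (badSet π) β π) (cong (_+ sumOver (∁ β ∩ badSet π) π) (sumOver-cong π bad-β))

  -- Every vertex of N[v] has a neighbour that is bad but not in β_v: its conflict partner.
  closedNbhd-dominated : ∀ w → closedNbhd G v w ≡ true →
                         ∃ λ p → (∁ β ∩ badSet π) p ≡ true × adj G p w ≡ true
  closedNbhd-dominated w w∈N[v] with conflict w
  ... | p , q , wp , wq , q≢w , step = p , p-bad-outside-β , adj-sym G wp
    where
    p∉β : β p ≡ false
    p∉β = ⌊⌋-false (π p ≟ π v + 1) λ dp → q-not-v (is-v (+1-injective (trans (sym step) dp)))
      where
      q-not-v : q ≢ v
      q-not-v q≡v with w F.≟ v
      ... | yes w≡v = q≢w (trans q≡v (sym w≡v))
      -- here w ≠ v, so w ∈ N[v] says that w is adjacent to v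
      ... | no  _ = contradiction (trans (sym (adj-sym G w∈N[v])) (subst (λ y → adj G w y ≡ false) q≡v wq)) λ ()
    p-bad-outside-β : (∁ β ∩ badSet π) p ≡ true
    p-bad-outside-β rewrite p∉β = ⌊⌋-true (FinP.any? (λ y → π y + 1 ≟ π p)) (q , sym step)

  sum-j<sum-bad : sumOver (jSet π v) π + 1 ≤ sumOver (badSet π) π
  sum-j<sum-bad = begin
    sumOver (jSet π v) π + 1                       ≡⟨ cong (_+ 1) sum-j ⟩
    π v + sumOver β π + 1                          ≡⟨ reorder (π v) (sumOver β π) ⟩
    sumOver β π + suc (π v)                        ≡⟨ cong (sumOver β π +_) (trans (cong suc (sym (realizes v))) (sym (card-closedNbhd G v))) ⟩
    sumOver β π + card (closedNbhd G v)            ≤⟨ +-monoʳ-≤ (sumOver β π) (card≤∑deg G π realizes _ _ closedNbhd-dominated) ⟩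
    sumOver β π + sumOver (∁ β ∩ badSet π) π       ≡⟨ sum-bad ⟨
    sumOver (badSet π) π                           ∎
    where
    open ≤-Reasoning
    reorder : ∀ d s → d + s + 1 ≡ s + suc d
    reorder = solve-∀

  module PartB (good : Good π v) (d≥3 : 3 ≤ π v) (b : Fin n) (db : π b ≡ π v + 1) where

    lowNbrs : VSet n
    lowNbrs = adj G v ∩ iSet π

    low : ∀ {x} → iSet π x ≡ true → π x < 3
    low {x} = ⌊⌋-sound (π x <? 3)

    v∉i : iSet π v ≡ false
    v∉i = ⌊⌋-false (π v <? 3) (λ lt → <⇒≱ lt d≥3)

    i⇒≢v : ∀ {x} → iSet π x ≡ true → x ≢ v
    i⇒≢v x∈i refl = contradiction (trans (sym x∈i) v∉i) λ ()

    low⇒not-b : ∀ {x} → π x < 3 → x ≢ b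
    low⇒not-b lt refl = <⇒≱ lt (≤-trans d≥3 (≤-trans (m≤m+n (π v) 1) (≤-reflexive (sym db))))

    b≢v : b ≢ v
    b≢v refl = n≢n+1 (π b) db

    -- A low neighbour w of v has degree 2 (its neighbours are v and the bad partner p
    -- of its conflict) and is not adjacent to b (b = p would force the partner of p
    -- to be v, and b ≠ p would give w a third neighbour).
    lowNbr-shape : ∀ w → lowNbrs w ≡ true → π w ≡ 2 × nonNbrs G b w ≡ true
    lowNbr-shape w w∈low with conflict w
    ... | p , q , wp , wq , q≢w , step = degree-2 , b-non-nbr
      where
      wv : adj G w v ≡ true
      wv = adj-sym G (proj₁ (∧-true w∈low))
      w-low : π w < 3
      w-low = low (proj₂ (∧-true w∈low))
      p≢v : p ≢ v
      p≢v refl = good (q , sym step)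
      degree-2 : π w ≡ 2
      degree-2 = ≤-antisym (≤-pred w-low)
                           (subst (2 ≤_) (realizes w) (card-≥2 (adj G w) (p≢v ∘ sym) wv wp))
      not-adjacent : adj G b w ≡ false
      not-adjacent with adj G b w in bw
      ... | false = refl
      ... | true with p F.≟ b
      ...   | yes p≡b = contradiction (trans (sym wv) (subst (λ y → adj G w y ≡ false) q≡v wq)) λ ()
        where
        q≡v : q ≡ v
        q≡v = is-v (+1-injective (trans (sym step) (trans (cong π p≡b) db)))
      ...   | no  p≢b = contradiction (subst (3 ≤_) (realizes w)
                          (card-≥3 (adj G w) (p≢v ∘ sym) (b≢v ∘ sym) p≢b wv wp (adj-sym G bw))) (<⇒≱ w-low)
      b-non-nbr : nonNbrs G b w ≡ true
      b-non-nbr rewrite ∉｛｝ (low⇒not-b w-low) | not-adjacent = refl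

    -- Either μ_i = 0, or b has a non-neighbour outside lowNbrs: the conflict
    -- partner z of b is such a vertex unless it is a low neighbour of v, in which case
    -- d_z = 2 and its partner has degree 3, witnessing μ_i = 0.
    μ-or-extra : μ π (iSet π) ≡ 0 ⊎ ∃ λ t → nonNbrs G b t ≡ true × lowNbrs t ≡ false
    μ-or-extra with conflict b
    ... | p , z , _ , bz , z≢b , step with lowNbrs z in z∈low
    ...   | false = inj₂ (z , z-non-nbr , z∈low)
      where
      z-non-nbr : nonNbrs G b z ≡ true
      z-non-nbr rewrite ∉｛｝ z≢b | bz = refl
    ...   | true = inj₁ (μ-vanishes π (iSet π) (proj₂ (∧-true z∈low)) p∉i (sym step))
      where
      p∉i : iSet π p ≡ false
      p∉i = ⌊⌋-false (π p <? 3) λ lt →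
              <⇒≱ lt (≤-reflexive (sym (trans step (cong (_+ 1) (proj₁ (lowNbr-shape z z∈low))))))

    lowNbrs+μ≤nonNbrs-b : card lowNbrs + μ π (iSet π) ≤ card (nonNbrs G b)
    lowNbrs+μ≤nonNbrs-b with μ-or-extra
    ... | inj₁ μ≡0 rewrite μ≡0 | +-identityʳ (card lowNbrs) =
          sumOver-mono _ (λ w w∈low → proj₂ (lowNbr-shape w w∈low))
    ... | inj₂ (t , t∈ , t∉) = begin
          card lowNbrs + μ π (iSet π)   ≤⟨ +-monoʳ-≤ (card lowNbrs) (μ≤1 π (iSet π)) ⟩
          card lowNbrs + 1              ≡⟨ +-comm (card lowNbrs) 1 ⟩
          suc (card lowNbrs)            ≤⟨ card-⊂ (λ w w∈low → proj₂ (lowNbr-shape w w∈low)) t∈ t∉ ⟩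
          card (nonNbrs G b)            ∎
      where open ≤-Reasoning

    -- A low-degree vertex is either a neighbour of v or one of its non-neighbours (v ∉ i).
    card-i : card (iSet π) ≤ card lowNbrs + card (nonNbrs G v)
    card-i = begin
      card (iSet π)                                     ≡⟨ sumOver-split (iSet π) (adj G v) _ ⟩
      card lowNbrs + card (∁ (adj G v) ∩ iSet π)        ≤⟨ +-monoʳ-≤ (card lowNbrs) (sumOver-mono _ farLow) ⟩
      card lowNbrs + card (nonNbrs G v)                 ∎
      where
      open ≤-Reasoning
      farLow : (∁ (adj G v) ∩ iSet π) ⊆ nonNbrs G v
      farLow x x∈ with ∧-true {not (adj G v x)} x∈
      ... | non-adjacent , x∈i rewrite ∉｛｝ (i⇒≢v x∈i) = non-adjacent

    2d+i+3+μ≤2n : 2 * π v + card (iSet π) + 3 + μ π (iSet π) ≤ 2 * n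
    2d+i+3+μ≤2n = begin
      2 * π v + card (iSet π) + 3 + μ π (iSet π)
        ≤⟨ +-monoˡ-≤ (μ π (iSet π)) (+-monoˡ-≤ 3 (+-monoʳ-≤ (2 * π v) card-i)) ⟩
      2 * π v + (card lowNbrs + card (nonNbrs G v)) + 3 + μ π (iSet π)
        ≡⟨ rearrange (π v) (card lowNbrs) (card (nonNbrs G v)) (μ π (iSet π)) ⟩
      (π v + suc (card (nonNbrs G v))) + ((π v + 1) + suc (card lowNbrs + μ π (iSet π)))
        ≤⟨ +-monoʳ-≤ (π v + suc (card (nonNbrs G v))) (+-monoʳ-≤ (π v + 1) (s≤s lowNbrs+μ≤nonNbrs-b)) ⟩
      (π v + suc (card (nonNbrs G v))) + ((π v + 1) + suc (card (nonNbrs G b)))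
        ≡⟨ cong₂ _+_ count-v count-b ⟩
      n + n
        ≡⟨ double n ⟩
      2 * n ∎
      where
      open ≤-Reasoning
      rearrange : ∀ d L A m → 2 * d + (L + A) + 3 + m ≡ (d + (1 + A)) + ((d + 1) + (1 + (L + m)))
      rearrange = solve-∀
      double : ∀ m → m + m ≡ 2 * m
      double = solve-∀
      count-v : π v + suc (card (nonNbrs G v)) ≡ n
      count-v = trans (cong (_+ suc (card (nonNbrs G v))) (sym (realizes v))) (vertex-count G v)
      count-b : (π v + 1) + suc (card (nonNbrs G b)) ≡ n
      count-b = trans (cong (_+ suc (card (nonNbrs G b))) (trans (sym db) (sym (realizes b)))) (vertex-count G b)

mainTheorem17 : (n : ℕ) (π : Fin n → ℕ) (v : Fin n) →
    Good π v → Dull π v → 3 ≤ π v →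
    (∀ u → u ≢ v → π u ≢ π v) →
    (sumOver (badSet π) π < sumOver (jSet π v) π + 1
      ⊎ 2 * n < 2 * π v + card (iSet π) + 3 + μ π (iSet π)) →
    DsReconstructionForcing π
mainTheorem17 n π v good (b , db) d≥3 unique hypothesis G realizes
  with reconstructible-or-conflicted G
... | inj₁ reconstructible = reconstructible
... | inj₂ conflicted      = ⊥-elim (refuted hypothesis)
  where
  open Conflicted π v unique G realizes conflicted
  refuted : sumOver (badSet π) π < sumOver (jSet π v) π + 1
              ⊎ 2 * n < 2 * π v + card (iSet π) + 3 + μ π (iSet π) → ⊥
  refuted (inj₁ lowBadSum) = <⇒≱ lowBadSum sum-j<sum-bad
  refuted (inj₂ highDegree) = <⇒≱ highDegree (PartB.2d+i+3+μ≤2n good d≥3 b db)
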